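{- For any nonempty matroid $M$ on a set $S$, $M$ is irreducible with respect to free product if and only if $M$ has no nontrivial free separator.
   Context: For a matroid $M$ on $S$, write $\rho(M)$ for its rank, $\nu_M(A)=|A|-\rho_M(A)$ and $\lambda_M(A)=\rho(M)-\rho_M(A)$. For matroids $M$ on $S$ and $N$ on $T$ with $S\cap T=\emptyset$, the free product $M\mathbin{\Box} N$ is the matroid on $S\cup T$ whose independent sets are the $A\subseteq S\cup T$ with $A\cap S$ independent in $M$ and $\lambda_M(A\cap S)\geq\nu_N(A\cap T)$. A nonempty matroid is irreducible if every factorization of it as a free product of matroids contains it as a factor. A cyclic flat is a flat that is a union of circuits. A set $A\subseteq S$ is a free separator of $M$ if every cyclic flat of $M$ is comparable to $A$ under inclusion; $\emptyset$ and $S$ are always free separators, and any other free separator is called nontrivial. -}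

module Defs where

open import Data.Nat using (ℕ; _+_; _∸_; _≤_; _<_)
open import Data.Fin using (Fin; _↑ˡ_; _↑ʳ_)
open import Data.Fin.Subset using (Subset; _⊆_; _∪_; _∩_; ∣_∣; ⁅_⁆; _∈_; _∉_; ⊤; ⊥)
open import Data.Vec using (tabulate; lookup)
open import Data.Product using (Σ; ∃; _×_)
open import Data.Sum using (_⊎_)
open import Relation.Nullary using (¬_)
open import Relation.Binary.PropositionalEquality using (_≡_; _≢_)
open import Function.Bundles using (_↔_; _⇔_; Inverse)

record Matroid (n : ℕ) : Set where
  field
    rk        : Subset n → ℕ
    rk-bound  : ∀ A → rk A ≤ ∣ A ∣
    rk-mono   : ∀ {A B} → A ⊆ B → rk A ≤ rk B
    rk-submod : ∀ A B → rk (A ∪ B) + rk (A ∩ B) ≤ rk A + rk B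

module _ {n : ℕ} (M : Matroid n) where
  open Matroid M

  rank : ℕ
  rank = rk ⊤

  Indep : Subset n → Set
  Indep A = rk A ≡ ∣ A ∣

  ν : Subset n → ℕ
  ν A = ∣ A ∣ ∸ rk A

  λ' : Subset n → ℕ
  λ' A = rank ∸ rk A

  Circuit : Subset n → Set
  Circuit C = ¬ Indep C × (∀ D → D ⊆ C → D ≢ C → Indep D)

  Flat : Subset n → Set
  Flat A = ∀ x → x ∉ A → rk A < rk (A ∪ ⁅ x ⁆)

  UnionOfCircuits : Subset n → Set
  UnionOfCircuits A = ∀ x → x ∈ A → ∃ λ C → Circuit C × x ∈ C × C ⊆ A

  CyclicFlat : Subset n → Set
  CyclicFlat F = Flat F × UnionOfCircuits F

  FreeSeparator : Subset n → Set
  FreeSeparator A = ∀ F → CyclicFlat F → F ⊆ A ⊎ A ⊆ F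

  NontrivialFreeSeparator : Subset n → Set
  NontrivialFreeSeparator A = FreeSeparator A × A ≢ ⊥ × A ≢ ⊤

restrictˡ : ∀ {a b} → Subset (a + b) → Subset a
restrictˡ {a} {b} A = tabulate (λ i → lookup A (i ↑ˡ b))

restrictʳ : ∀ {a b} → Subset (a + b) → Subset b
restrictʳ {a} {b} A = tabulate (λ j → lookup A (a ↑ʳ j))

-- Independent sets of the free product M □ N on Fin a ⊎ Fin b ≅ Fin (a + b).
FreeProductIndep : ∀ {a b} → Matroid a → Matroid b → Subset (a + b) → Set
FreeProductIndep M N A =
  Indep M (restrictˡ A) × ν N (restrictʳ A) ≤ λ' M (restrictˡ A)

pullback : ∀ {m n} → Fin m ↔ Fin n → Subset n → Subset m
pullback σ B = tabulate (λ j → lookup B (Inverse.to σ j))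

IsoToIndep : ∀ {n m} → Matroid n → (Subset m → Set) → Set
IsoToIndep {n} {m} M I =
  Σ (Fin m ↔ Fin n) λ σ → ∀ (B : Subset n) → Indep M B ⇔ I (pullback σ B)

_≅ᴹ_ : ∀ {m n} → Matroid m → Matroid n → Set
N ≅ᴹ M = IsoToIndep M (Indep N)

IsFactorization : ∀ {n a b} → Matroid n → Matroid a → Matroid b → Set
IsFactorization M N₁ N₂ = IsoToIndep M (FreeProductIndep N₁ N₂)

Irreducible : ∀ {n} → Matroid n → Set
Irreducible {n} M =
  0 < n × (∀ a b (N₁ : Matroid a) (N₂ : Matroid b) →
             IsFactorization M N₁ N₂ → N₁ ≅ᴹ M ⊎ N₂ ≅ᴹ M)

-- If A is a nontrivial free separator, then for every dependent set B whose part B ∩ A is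
-- independent, a circuit C ⊆ B must leave A, so the cyclic flat cl C contains A and
-- rk (A ∪ B) ≤ rk C + ∣ B ─ cl C ∣ < ∣ B ∣. Hence B is independent exactly when B ∩ A is
-- independent and ∣ B ∣ ≤ rk (A ∪ B), which is independence in (M|A) □ (M/A): a
-- factorization of M into two matroids on fewer elements.
--
-- Conversely, in N₁ □ N₂ replacing an element of the first ground set by an element of the
-- second preserves independence. If a cyclic flat F contained an element x of the second
-- ground set but missed an element y of the first, then for a circuit C ∋ x inside F the
-- set (C - x) ∪ ⁅ y ⁆ is independent because F is a flat, and exchanging y for x would make
-- C independent. So the first ground set is a free separator; it is nontrivial unless a
-- factor is empty, and an empty factor leaves the other one isomorphic to the product.
module Submission where

open import Data.Bool using (Bool; true; false; if_then_else_; _∨_; _∧_)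
open import Data.Bool.Properties using (∨-identityʳ)
open import Data.Empty using (⊥-elim)
open import Data.Fin using (Fin; zero; suc; _↑ˡ_; _↑ʳ_; splitAt) renaming (_≟_ to _≟ᶠ_)
open import Data.Fin.Permutation using (↔⇒≡)
open import Data.Fin.Properties using (+↔⊎; splitAt-↑ˡ; splitAt-↑ʳ; splitAt⁻¹-↑ˡ; splitAt⁻¹-↑ʳ)
open import Data.Fin.Subset
open import Data.Fin.Subset.Induction using (Acc; acc; ⊂-wellFounded)
open import Data.Fin.Subset.Properties
open import Data.Nat using (ℕ; zero; suc; _+_; _∸_; _≤_; _<_; _≟_; s≤s; z≤n)
open import Data.Nat.Properties
open import Algebra.Properties.CommutativeMonoid.Sum +-0-commutativeMonoid using (sum; sum-cong-≗; sum-permute)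
open import Algebra.Properties.CommutativeSemigroup +-commutativeSemigroup using (interchange)
open import Data.Product using (∃; _×_; _,_; proj₁; proj₂)
open import Data.Sum using (_⊎_; inj₁; inj₂; [_,_]′; map₁)
open import Data.Sum.Algebra using (⊎-comm)
open import Data.Vec using (Vec; []; _∷_; _++_; lookup; tabulate; zipWith; here; there)
open import Data.Vec.Properties using (lookup∘tabulate; tabulate∘lookup; tabulate-cong; lookup-zipWith; []=⇒lookup; lookup⇒[]=; lookup-++ˡ; lookup-++ʳ; zipWith-++)
open import Function using (_∘_; id; case_of_; Injective; _⇔_; mk⇔; Equivalence; _↔_; Inverse; mk↔ₛ′)
open import Function.Construct.Composition using (_↔-∘_; _⇔-∘_)
open import Function.Construct.Identity using (⇔-id)
open import Function.Construct.Symmetry using (↔-sym)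
open import Level using (0ℓ)
open import Relation.Binary.PropositionalEquality
open import Relation.Nullary using (¬_; Dec; yes; no; does)
open import Relation.Nullary.Decidable using (decidable-stable; ¬?; _×-dec_; dec-true; dec-false)
open import Relation.Unary using (Pred; Decidable)

open import Defs

private variable
  m n a b : ℕ

-- Subsets

∈-transport : ∀ {p : Subset m} {q : Subset n} {i j} → lookup p i ≡ lookup q j → i ∈ p → j ∈ q
∈-transport {q = q} {j = j} eq i∈p = lookup⇒[]= j q (trans (sym eq) ([]=⇒lookup i∈p))

lookup-ext : ∀ {A : Set} {p q : Vec A n} → (∀ i → lookup p i ≡ lookup q i) → p ≡ q
lookup-ext {p = p} {q} eq = trans (sym (tabulate∘lookup p)) (trans (tabulate-cong eq) (tabulate∘lookup q))

∪-⊆ : ∀ {p q r : Subset n} → p ⊆ r → q ⊆ r → p ∪ q ⊆ r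
∪-⊆ {p = p} {q} p⊆r q⊆r x∈ = [ p⊆r , q⊆r ]′ (x∈p∪q⁻ p q x∈)

⊆-∩ : ∀ {p q r : Subset n} → r ⊆ p → r ⊆ q → r ⊆ p ∩ q
⊆-∩ r⊆p r⊆q x∈ = x∈p∩q⁺ (r⊆p x∈ , r⊆q x∈)

∪-monoˡ-⊆ : ∀ {p p′ q : Subset n} → p ⊆ p′ → p ∪ q ⊆ p′ ∪ q
∪-monoˡ-⊆ {p′ = p′} {q} p⊆p′ = ∪-⊆ (p⊆p∪q q ∘ p⊆p′) (q⊆p∪q p′ q)

∪-monoʳ-⊆ : ∀ {p q q′ : Subset n} → q ⊆ q′ → p ∪ q ⊆ p ∪ q′
∪-monoʳ-⊆ {p = p} {q′ = q′} q⊆q′ = ∪-⊆ (p⊆p∪q q′) (q⊆p∪q p q′ ∘ q⊆q′)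

x∈p⇒⁅x⁆⊆p : ∀ {p : Subset n} {x} → x ∈ p → ⁅ x ⁆ ⊆ p
x∈p⇒⁅x⁆⊆p {p = p} {x} x∈p y∈⁅x⁆ = subst (_∈ p) (sym (x∈⁅y⁆⇒x≡y x y∈⁅x⁆)) x∈p

x∈p─q⇒x∉q : ∀ {p q : Subset n} {x} → x ∈ p ─ q → x ∉ q
x∈p─q⇒x∉q {p = _ ∷ _} {false ∷ _} here ()
x∈p─q⇒x∉q {p = _ ∷ _} {_ ∷ _} (there x∈p─q) (there x∈q) = x∈p─q⇒x∉q x∈p─q x∈q

x∉p-x : ∀ (p : Subset n) x → x ∉ p - x
x∉p-x p x x∈p-x = x∈p─q⇒x∉q x∈p-x (x∈⁅x⁆ x)

p-x∪⁅x⁆≡p : ∀ {p : Subset n} {x} → x ∈ p → (p - x) ∪ ⁅ x ⁆ ≡ p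
p-x∪⁅x⁆≡p {p = p} {x} x∈p = ⊆-antisym (∪-⊆ (p─q⊆p p ⁅ x ⁆) (x∈p⇒⁅x⁆⊆p x∈p)) p⊆
  where
  p⊆ : p ⊆ (p - x) ∪ ⁅ x ⁆
  p⊆ {y} y∈p with y ≟ᶠ x
  ... | yes refl = q⊆p∪q (p - x) ⁅ x ⁆ (x∈⁅x⁆ x)
  ... | no y≢x = p⊆p∪q ⁅ x ⁆ (x∈p∧x≢y⇒x∈p-y y∈p y≢x)

⊈⇒∃∈∉ : ∀ {p q : Subset n} → ¬ p ⊆ q → ∃ λ x → x ∈ p × x ∉ q
⊈⇒∃∈∉ {p = p} {q} p⊈q with nonempty? (p ─ q)
... | yes (x , x∈p─q) = x , p─q⊆p p q x∈p─q , x∈p─q⇒x∉q x∈p─q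
... | no p─q-empty = ⊥-elim (p⊈q λ {x} x∈p →
        decidable-stable (x ∈? q) λ x∉q → p─q-empty (x , x∈p∧x∉q⇒x∈p─q x∈p x∉q))

⊆∧≢⇒⊂ : ∀ {p q : Subset n} → p ⊆ q → p ≢ q → p ⊂ q
⊆∧≢⇒⊂ p⊆q p≢q = p⊆q , ⊈⇒∃∈∉ (λ q⊆p → p≢q (⊆-antisym p⊆q q⊆p))

⊂-minimal : ∀ {P : Pred (Subset n) 0ℓ} → Decidable P → ∀ {X} → P X →
            ∃ λ Y → Y ⊆ X × P Y × (∀ {Z} → Z ⊂ Y → ¬ P Z)
⊂-minimal {P = P} P? {X} PX = go X (⊂-wellFounded X) PX
  where
  go : ∀ X → Acc _⊂_ X → P X → ∃ λ Y → Y ⊆ X × P Y × (∀ {Z} → Z ⊂ Y → ¬ P Z)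
  go X (acc smaller) PX with anySubset? (λ Z → (Z ⊂? X) ×-dec P? Z)
  ... | no none = X , ⊆-refl , PX , λ Z⊂X PZ → none (_ , Z⊂X , PZ)
  ... | yes (Z , Z⊂X , PZ) with go Z (smaller Z⊂X) PZ
  ...   | Y , Y⊆Z , PY , minimal = Y , ⊆-trans Y⊆Z (p⊂q⇒p⊆q Z⊂X) , PY , minimal

satisfying : ∀ {P : Pred (Fin n) 0ℓ} → Decidable P → Subset n
satisfying P? = tabulate (does ∘ P?)

module _ {P : Pred (Fin n) 0ℓ} (P? : Decidable P) where

  ∈-satisfying⁺ : ∀ {x} → P x → x ∈ satisfying P?
  ∈-satisfying⁺ {x} Px = lookup⇒[]= x _ (trans (lookup∘tabulate (does ∘ P?) x) (dec-true (P? x) Px))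

  ∈-satisfying⁻ : ∀ {x} → x ∈ satisfying P? → P x
  ∈-satisfying⁻ {x} x∈ = decidable-stable (P? x) λ ¬Px → true≢false
    (trans (trans (sym ([]=⇒lookup x∈)) (lookup∘tabulate (does ∘ P?) x)) (dec-false (P? x) ¬Px))
    where
    true≢false : true ≢ false
    true≢false ()

∣p∪⁅x⁆∣≤1+∣p∣ : ∀ (p : Subset n) x → ∣ p ∪ ⁅ x ⁆ ∣ ≤ suc ∣ p ∣
∣p∪⁅x⁆∣≤1+∣p∣ (true ∷ p) zero = s≤s (m≤n⇒m≤1+n (≤-reflexive (cong ∣_∣ (∪-identityʳ p))))
∣p∪⁅x⁆∣≤1+∣p∣ (false ∷ p) zero = s≤s (≤-reflexive (cong ∣_∣ (∪-identityʳ p)))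
∣p∪⁅x⁆∣≤1+∣p∣ (true ∷ p) (suc x) = s≤s (∣p∪⁅x⁆∣≤1+∣p∣ p x)
∣p∪⁅x⁆∣≤1+∣p∣ (false ∷ p) (suc x) = ∣p∪⁅x⁆∣≤1+∣p∣ p x

∣p∪⁅x⁆∣≡1+∣p∣ : ∀ (p : Subset n) {x} → x ∉ p → ∣ p ∪ ⁅ x ⁆ ∣ ≡ suc ∣ p ∣
∣p∪⁅x⁆∣≡1+∣p∣ (true ∷ p) {zero} x∉p = ⊥-elim (x∉p here)
∣p∪⁅x⁆∣≡1+∣p∣ (false ∷ p) {zero} _ = cong (suc ∘ ∣_∣) (∪-identityʳ p)
∣p∪⁅x⁆∣≡1+∣p∣ (true ∷ p) {suc x} x∉p = cong suc (∣p∪⁅x⁆∣≡1+∣p∣ p (x∉p ∘ there))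
∣p∪⁅x⁆∣≡1+∣p∣ (false ∷ p) {suc x} x∉p = ∣p∪⁅x⁆∣≡1+∣p∣ p (x∉p ∘ there)

∣p∣≡1+∣p-x∣ : ∀ {p : Subset n} {x} → x ∈ p → ∣ p ∣ ≡ suc ∣ p - x ∣
∣p∣≡1+∣p-x∣ {p = p} {x} x∈p = trans (cong ∣_∣ (sym (p-x∪⁅x⁆≡p x∈p))) (∣p∪⁅x⁆∣≡1+∣p∣ (p - x) (x∉p-x p x))

∣p∩q∣+∣p─q∣≡∣p∣ : ∀ (p q : Subset n) → ∣ p ∩ q ∣ + ∣ p ─ q ∣ ≡ ∣ p ∣
∣p∩q∣+∣p─q∣≡∣p∣ [] [] = refl
∣p∩q∣+∣p─q∣≡∣p∣ (true ∷ p) (true ∷ q) = cong suc (∣p∩q∣+∣p─q∣≡∣p∣ p q)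
∣p∩q∣+∣p─q∣≡∣p∣ (true ∷ p) (false ∷ q) = trans (+-suc _ _) (cong suc (∣p∩q∣+∣p─q∣≡∣p∣ p q))
∣p∩q∣+∣p─q∣≡∣p∣ (false ∷ p) (true ∷ q) = ∣p∩q∣+∣p─q∣≡∣p∣ p q
∣p∩q∣+∣p─q∣≡∣p∣ (false ∷ p) (false ∷ q) = ∣p∩q∣+∣p─q∣≡∣p∣ p q

∣∁p∣≡n⇒p≡⊥ : ∀ {p : Subset n} → ∣ ∁ p ∣ ≡ n → p ≡ ⊥
∣∁p∣≡n⇒p≡⊥ {p = p} ∣∁p∣≡n = Empty-unique λ (x , x∈p) →
  x∈p⇒x∉∁p x∈p (subst (x ∈_) (sym (∣p∣≡n⇒p≡⊤ ∣∁p∣≡n)) ∈⊤)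

preimage : (Fin m → Fin n) → Subset n → Subset m
preimage f p = tabulate (lookup p ∘ f)

module _ (f : Fin m → Fin n) where

  lookup-preimage : ∀ p i → lookup (preimage f p) i ≡ lookup p (f i)
  lookup-preimage p = lookup∘tabulate (lookup p ∘ f)

  ∈-preimage⁻ : ∀ {p i} → i ∈ preimage f p → f i ∈ p
  ∈-preimage⁻ {p} {i} = ∈-transport (lookup-preimage p i)

  ∈-preimage⁺ : ∀ {p i} → f i ∈ p → i ∈ preimage f p
  ∈-preimage⁺ {p} {i} = ∈-transport (sym (lookup-preimage p i))

  preimage-mono : ∀ {p q} → p ⊆ q → preimage f p ⊆ preimage f q
  preimage-mono p⊆q = ∈-preimage⁺ ∘ p⊆q ∘ ∈-preimage⁻

  preimage-zipWith : ∀ (g : Bool → Bool → Bool) p q →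
                     preimage f (zipWith g p q) ≡ zipWith g (preimage f p) (preimage f q)
  preimage-zipWith g p q = lookup-ext λ i → begin
    lookup (preimage f (zipWith g p q)) i                 ≡⟨ lookup-preimage (zipWith g p q) i ⟩
    lookup (zipWith g p q) (f i)                          ≡⟨ lookup-zipWith g (f i) p q ⟩
    g (lookup p (f i)) (lookup q (f i))                   ≡⟨ cong₂ g (lookup-preimage p i) (lookup-preimage q i) ⟨
    g (lookup (preimage f p) i) (lookup (preimage f q) i) ≡⟨ lookup-zipWith g i (preimage f p) (preimage f q) ⟨
    lookup (zipWith g (preimage f p) (preimage f q)) i    ∎
    where open ≡-Reasoning

  preimage-∪ : ∀ p q → preimage f (p ∪ q) ≡ preimage f p ∪ preimage f q
  preimage-∪ = preimage-zipWith _∨_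

  preimage-∩ : ∀ p q → preimage f (p ∩ q) ≡ preimage f p ∩ preimage f q
  preimage-∩ = preimage-zipWith _∧_

  preimage-⁅⁆ : Injective _≡_ _≡_ f → ∀ i → preimage f ⁅ f i ⁆ ≡ ⁅ i ⁆
  preimage-⁅⁆ f-inj i = ⊆-antisym
    (λ j∈ → subst (_∈ ⁅ i ⁆) (sym (f-inj (x∈⁅y⁆⇒x≡y _ (∈-preimage⁻ j∈)))) (x∈⁅x⁆ i))
    (λ j∈ → ∈-preimage⁺ (subst (λ j → f j ∈ ⁅ f i ⁆) (sym (x∈⁅y⁆⇒x≡y i j∈)) (x∈⁅x⁆ (f i))))

preimage-∘ : ∀ {o} (f : Fin n → Fin o) (g : Fin m → Fin n) p → preimage g (preimage f p) ≡ preimage (f ∘ g) p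
preimage-∘ f g p = tabulate-cong λ i → lookup-preimage f p (g i)

module _ (σ : Fin m ↔ Fin n) where
  open Inverse σ

  preimage-inverse : ∀ p → preimage from (preimage to p) ≡ p
  preimage-inverse p = trans (preimage-∘ to from p)
    (trans (tabulate-cong (cong (lookup p) ∘ strictlyInverseˡ)) (tabulate∘lookup p))

  preimage-∪⁅⁆ : ∀ p z → preimage to (p ∪ ⁅ z ⁆) ≡ preimage to p ∪ ⁅ from z ⁆
  preimage-∪⁅⁆ p z = trans (preimage-∪ to p ⁅ z ⁆) (cong (preimage to p ∪_) (begin
    preimage to ⁅ z ⁆             ≡⟨ cong (preimage to ∘ ⁅_⁆) (strictlyInverseˡ z) ⟨
    preimage to ⁅ to (from z) ⁆   ≡⟨ preimage-⁅⁆ to to-injective (from z) ⟩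
    ⁅ from z ⁆                    ∎))
    where
    open ≡-Reasoning
    to-injective : Injective _≡_ _≡_ to
    to-injective {x} {y} eq = trans (sym (strictlyInverseʳ x)) (trans (cong from eq) (strictlyInverseʳ y))

  ∣preimage∣ : ∀ p → ∣ preimage to p ∣ ≡ ∣ p ∣
  ∣preimage∣ p = begin
    ∣ preimage to p ∣                 ≡⟨ ∣p∣≡∑ (preimage to p) ⟩
    sum (indicator (preimage to p))   ≡⟨ sum-cong-≗ (cong (if_then 1 else 0) ∘ lookup-preimage to p) ⟩
    sum (indicator p ∘ to)            ≡⟨ sum-permute (indicator p) σ ⟨
    sum (indicator p)                 ≡⟨ ∣p∣≡∑ p ⟨
    ∣ p ∣                             ∎
    where
    open ≡-Reasoning
    indicator : ∀ {k} → Subset k → Fin k → ℕ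
    indicator p i = if lookup p i then 1 else 0
    ∣p∣≡∑ : ∀ {k} (p : Subset k) → ∣ p ∣ ≡ sum (indicator p)
    ∣p∣≡∑ [] = refl
    ∣p∣≡∑ (true ∷ p) = cong suc (∣p∣≡∑ p)
    ∣p∣≡∑ (false ∷ p) = ∣p∣≡∑ p

-- The two blocks of Fin (a + b)

firstBlock : ∀ a b → Subset (a + b)
firstBlock a b = ⊤ {a} ++ ⊥ {b}

↑ˡ⊎↑ʳ : ∀ a (k : Fin (a + b)) → (∃ λ i → k ≡ i ↑ˡ b) ⊎ (∃ λ j → k ≡ a ↑ʳ j)
↑ˡ⊎↑ʳ a k with splitAt a k in eq
... | inj₁ i = inj₁ (i , sym (splitAt⁻¹-↑ˡ eq))
... | inj₂ j = inj₂ (j , sym (splitAt⁻¹-↑ʳ eq))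

∣++∣ : ∀ (Y : Subset a) (Z : Subset b) → ∣ Y ++ Z ∣ ≡ ∣ Y ∣ + ∣ Z ∣
∣++∣ [] Z = refl
∣++∣ (true ∷ Y) Z = cong suc (∣++∣ Y Z)
∣++∣ (false ∷ Y) Z = ∣++∣ Y Z

∣p++⊥∣≡∣p∣ : ∀ (p : Subset a) → ∣ p ++ ⊥ {b} ∣ ≡ ∣ p ∣
∣p++⊥∣≡∣p∣ {b = b} p =
  trans (∣++∣ p (⊥ {b})) (trans (cong (∣ p ∣ +_) (∣⊥∣≡0 b)) (+-identityʳ ∣ p ∣))

∣⊥++q∣≡∣q∣ : ∀ (q : Subset b) → ∣ ⊥ {a} ++ q ∣ ≡ ∣ q ∣
∣⊥++q∣≡∣q∣ {a = a} q = trans (∣++∣ (⊥ {a}) q) (cong (_+ ∣ q ∣) (∣⊥∣≡0 a))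

++⁺-⊆ : ∀ {Y Y′ : Subset a} {Z Z′ : Subset b} → Y ⊆ Y′ → Z ⊆ Z′ → Y ++ Z ⊆ Y′ ++ Z′
++⁺-⊆ {Y = []} {[]} _ Z⊆ x∈ = Z⊆ x∈
++⁺-⊆ {Y = _ ∷ _} {_ ∷ _} Y⊆ Z⊆ here with Y⊆ here
... | here = here
++⁺-⊆ {Y = _ ∷ _} {_ ∷ _} Y⊆ Z⊆ (there x∈) = there (++⁺-⊆ (drop-∷-⊆ Y⊆) Z⊆ x∈)

↑ˡ∈firstBlock : ∀ (i : Fin a) → i ↑ˡ b ∈ firstBlock a b
↑ˡ∈firstBlock {a = a} {b = b} i = ∈-transport (sym (lookup-++ˡ (⊤ {a}) (⊥ {b}) i)) (∈⊤ {x = i})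

↑ʳ∉firstBlock : ∀ (j : Fin b) → a ↑ʳ j ∉ firstBlock a b
↑ʳ∉firstBlock {b = b} {a = a} j = ∉⊥ {x = j} ∘ ∈-transport (lookup-++ʳ (⊤ {a}) (⊥ {b}) j)

restrictˡ-++ : ∀ (Y : Subset a) (Z : Subset b) → restrictˡ (Y ++ Z) ≡ Y
restrictˡ-++ [] Z = refl
restrictˡ-++ (y ∷ Y) Z = cong (y ∷_) (restrictˡ-++ Y Z)

restrictʳ-++ : ∀ (Y : Subset a) (Z : Subset b) → restrictʳ {a} (Y ++ Z) ≡ Z
restrictʳ-++ [] Z = tabulate∘lookup Z
restrictʳ-++ (y ∷ Y) Z = restrictʳ-++ Y Z

restrict-++ : ∀ a (P : Subset (a + b)) → restrictˡ {a} P ++ restrictʳ P ≡ P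
restrict-++ zero P = tabulate∘lookup P
restrict-++ (suc a) (x ∷ P) = cong (x ∷_) (restrict-++ a P)

++-∪-⁅↑ˡ⁆ : ∀ (Y : Subset a) (Z : Subset b) i → (Y ++ Z) ∪ ⁅ i ↑ˡ b ⁆ ≡ (Y ∪ ⁅ i ⁆) ++ Z
++-∪-⁅↑ˡ⁆ (y ∷ Y) Z zero =
  cong ((y ∨ true) ∷_) (trans (∪-identityʳ (Y ++ Z)) (cong (_++ Z) (sym (∪-identityʳ Y))))
++-∪-⁅↑ˡ⁆ (y ∷ Y) Z (suc i) = cong ((y ∨ false) ∷_) (++-∪-⁅↑ˡ⁆ Y Z i)

++-∪-⁅↑ʳ⁆ : ∀ (Y : Subset a) (Z : Subset b) j → (Y ++ Z) ∪ ⁅ a ↑ʳ j ⁆ ≡ Y ++ (Z ∪ ⁅ j ⁆)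
++-∪-⁅↑ʳ⁆ [] Z j = refl
++-∪-⁅↑ʳ⁆ (y ∷ Y) Z j = cong₂ _∷_ (∨-identityʳ y) (++-∪-⁅↑ʳ⁆ Y Z j)

-- Rank, closure and circuits

module _ (M : Matroid n) where
  open Matroid M

  Indep? : ∀ X → Dec (Indep M X)
  Indep? X = rk X ≟ ∣ X ∣

  Indep⇔ν≤0 : ∀ X → Indep M X ⇔ ν M X ≤ 0
  Indep⇔ν≤0 X = mk⇔
    (λ X-indep → ≤-reflexive (trans (cong (∣ X ∣ ∸_) X-indep) (n∸n≡0 ∣ X ∣)))
    (λ ν≤0 → ≤-antisym (rk-bound X) (m∸n≡0⇒m≤n (n≤0⇒n≡0 ν≤0)))

  rk-∪-≤ : ∀ X Y → rk (X ∪ Y) ≤ rk X + ∣ Y ∣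
  rk-∪-≤ X Y = begin
    rk (X ∪ Y)                ≤⟨ m≤m+n (rk (X ∪ Y)) (rk (X ∩ Y)) ⟩
    rk (X ∪ Y) + rk (X ∩ Y)   ≤⟨ rk-submod X Y ⟩
    rk X + rk Y               ≤⟨ +-monoʳ-≤ (rk X) (rk-bound Y) ⟩
    rk X + ∣ Y ∣              ∎
    where open ≤-Reasoning

  rk-∪-─ : ∀ X B → rk (X ∪ B) ≤ rk X + ∣ B ─ X ∣
  rk-∪-─ X B = ≤-trans (rk-mono X∪B⊆) (rk-∪-≤ X (B ─ X))
    where
    X∪B⊆ : X ∪ B ⊆ X ∪ (B ─ X)
    X∪B⊆ = ∪-⊆ (p⊆p∪q (B ─ X)) λ {x} x∈B → case x ∈? X of λ where
      (yes x∈X) → p⊆p∪q (B ─ X) x∈X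
      (no x∉X) → q⊆p∪q X (B ─ X) (x∈p∧x∉q⇒x∈p─q x∈B x∉X)

  indep-⊆ : ∀ {X B} → X ⊆ B → Indep M B → Indep M X
  indep-⊆ {X} {B} X⊆B B-indep = ≤-antisym (rk-bound X) (+-cancelʳ-≤ ∣ B ─ X ∣ ∣ X ∣ (rk X) (begin
    ∣ X ∣ + ∣ B ─ X ∣       ≡⟨ cong (λ Y → ∣ Y ∣ + ∣ B ─ X ∣) B∩X≡X ⟨
    ∣ B ∩ X ∣ + ∣ B ─ X ∣   ≡⟨ ∣p∩q∣+∣p─q∣≡∣p∣ B X ⟩
    ∣ B ∣                   ≡⟨ B-indep ⟨
    rk B                    ≤⟨ rk-mono (q⊆p∪q X B) ⟩
    rk (X ∪ B)              ≤⟨ rk-∪-─ X B ⟩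
    rk X + ∣ B ─ X ∣        ∎))
    where
    open ≤-Reasoning
    B∩X≡X : B ∩ X ≡ X
    B∩X≡X = ⊆-antisym (p∩q⊆q B X) (⊆-∩ X⊆B ⊆-refl)

  indep-⊥ : Indep M ⊥
  indep-⊥ = trans (n≤0⇒n≡0 (≤-trans (rk-bound ⊥) (≤-reflexive (∣⊥∣≡0 n)))) (sym (∣⊥∣≡0 n))

  rk-∪-stable : ∀ {X Y Z} → rk (X ∪ Y) ≡ rk X → rk (X ∪ Z) ≡ rk X → rk (X ∪ (Y ∪ Z)) ≡ rk X
  rk-∪-stable {X} {Y} {Z} XY XZ = ≤-antisym (+-cancelʳ-≤ (rk X) _ _ (begin
    rk (X ∪ (Y ∪ Z)) + rk X                          ≤⟨ +-mono-≤ (rk-mono ⊆∪) (rk-mono ⊆∩) ⟩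
    rk ((X ∪ Y) ∪ (X ∪ Z)) + rk ((X ∪ Y) ∩ (X ∪ Z))  ≤⟨ rk-submod (X ∪ Y) (X ∪ Z) ⟩
    rk (X ∪ Y) + rk (X ∪ Z)                          ≡⟨ cong₂ _+_ XY XZ ⟩
    rk X + rk X                                      ∎)) (rk-mono (p⊆p∪q (Y ∪ Z)))
    where
    open ≤-Reasoning
    ⊆∪ : X ∪ (Y ∪ Z) ⊆ (X ∪ Y) ∪ (X ∪ Z)
    ⊆∪ = ∪-⊆ (p⊆p∪q (X ∪ Z) ∘ p⊆p∪q Y)
              (∪-⊆ (p⊆p∪q (X ∪ Z) ∘ q⊆p∪q X Y) (q⊆p∪q (X ∪ Y) (X ∪ Z) ∘ q⊆p∪q X Z))
    ⊆∩ : X ⊆ (X ∪ Y) ∩ (X ∪ Z)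
    ⊆∩ = ⊆-∩ (p⊆p∪q Y) (p⊆p∪q Z)

  rk-∪-absorb : ∀ X Y → (∀ {y} → y ∈ Y → rk (X ∪ ⁅ y ⁆) ≡ rk X) → rk (X ∪ Y) ≡ rk X
  rk-∪-absorb X Y = go Y (⊂-wellFounded Y)
    where
    go : ∀ Y → Acc _⊂_ Y → (∀ {y} → y ∈ Y → rk (X ∪ ⁅ y ⁆) ≡ rk X) → rk (X ∪ Y) ≡ rk X
    go Y (acc smaller) absorbs with nonempty? Y
    ... | no empty = cong rk (trans (cong (X ∪_) (Empty-unique empty)) (∪-identityʳ X))
    ... | yes (y , y∈Y) = subst (λ Y → rk (X ∪ Y) ≡ rk X) (p-x∪⁅x⁆≡p y∈Y)
            (rk-∪-stable (go (Y - y) (smaller (x∈p⇒p-x⊂p y∈Y)) (absorbs ∘ p─q⊆p Y ⁅ y ⁆)) (absorbs y∈Y))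

  cl : Subset n → Subset n
  cl X = satisfying λ z → rk (X ∪ ⁅ z ⁆) ≟ rk X

  ∈-cl⁺ : ∀ {X z} → rk (X ∪ ⁅ z ⁆) ≡ rk X → z ∈ cl X
  ∈-cl⁺ {X} = ∈-satisfying⁺ λ z → rk (X ∪ ⁅ z ⁆) ≟ rk X

  ∈-cl⁻ : ∀ {X z} → z ∈ cl X → rk (X ∪ ⁅ z ⁆) ≡ rk X
  ∈-cl⁻ {X} = ∈-satisfying⁻ λ z → rk (X ∪ ⁅ z ⁆) ≟ rk X

  ⊆-cl : ∀ {X} → X ⊆ cl X
  ⊆-cl {X} {z} z∈X = ∈-cl⁺ (cong rk (⊆-antisym (∪-⊆ ⊆-refl (x∈p⇒⁅x⁆⊆p z∈X)) (p⊆p∪q ⁅ z ⁆)))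

  rk-cl : ∀ X → rk (cl X) ≡ rk X
  rk-cl X = ≤-antisym
    (≤-trans (rk-mono (q⊆p∪q X (cl X))) (≤-reflexive (rk-∪-absorb X (cl X) ∈-cl⁻)))
    (rk-mono ⊆-cl)

  cl-flat : ∀ X → Flat M (cl X)
  cl-flat X z z∉cl = begin-strict
    rk (cl X)            ≡⟨ rk-cl X ⟩
    rk X                 <⟨ ≤∧≢⇒< (rk-mono (p⊆p∪q ⁅ z ⁆)) (z∉cl ∘ ∈-cl⁺ ∘ sym) ⟩
    rk (X ∪ ⁅ z ⁆)       ≤⟨ rk-mono (∪-monoˡ-⊆ ⊆-cl) ⟩
    rk (cl X ∪ ⁅ z ⁆)    ∎
    where open ≤-Reasoning

  circuit-rk< : ∀ {C} → Circuit M C → rk C < ∣ C ∣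
  circuit-rk< {C} (C-dep , _) = ≤∧≢⇒< (rk-bound C) C-dep

  circuit-intro : ∀ {C} → ¬ Indep M C → (∀ {D} → D ⊂ C → Indep M D) → Circuit M C
  circuit-intro C-dep ⊂⇒indep = C-dep , λ D D⊆C D≢C → ⊂⇒indep (⊆∧≢⇒⊂ D⊆C D≢C)

  circuit-⊂ : ∀ {C D} → Circuit M C → D ⊂ C → Indep M D
  circuit-⊂ {D = D} (_ , minimal) D⊂C = minimal D (p⊂q⇒p⊆q D⊂C) λ D≡C → ⊂-irref D≡C D⊂C

  circuit-nonempty : ∀ {C} → Circuit M C → Nonempty C
  circuit-nonempty {C} (C-dep , _) with nonempty? C
  ... | yes c∈C = c∈C
  ... | no empty = ⊥-elim (C-dep (subst (Indep M) (sym (Empty-unique empty)) indep-⊥))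

  dependent⇒⊇circuit : ∀ {B} → ¬ Indep M B → ∃ λ C → Circuit M C × C ⊆ B
  dependent⇒⊇circuit B-dep with ⊂-minimal (¬? ∘ Indep?) B-dep
  ... | C , C⊆B , C-dep , minimal =
    C , circuit-intro C-dep (λ {D} D⊂C → decidable-stable (Indep? D) (minimal D⊂C)) , C⊆B

  circuit-exchange-dependent : ∀ {C c z} → Circuit M C → c ∈ C → z ∉ C → rk (C ∪ ⁅ z ⁆) ≡ rk C →
                               ¬ Indep M ((C - c) ∪ ⁅ z ⁆)
  circuit-exchange-dependent {C} {c} {z} C-circ c∈C z∉C z∈cl C₀-indep = <⇒≱ (circuit-rk< C-circ) (begin
    ∣ C ∣                   ≡⟨ ∣p∣≡1+∣p-x∣ c∈C ⟩
    suc ∣ C - c ∣           ≡⟨ ∣p∪⁅x⁆∣≡1+∣p∣ (C - c) (z∉C ∘ p─q⊆p C ⁅ c ⁆) ⟨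
    ∣ (C - c) ∪ ⁅ z ⁆ ∣     ≡⟨ C₀-indep ⟨
    rk ((C - c) ∪ ⁅ z ⁆)    ≤⟨ rk-mono (∪-monoˡ-⊆ (p─q⊆p C ⁅ c ⁆)) ⟩
    rk (C ∪ ⁅ z ⁆)          ≡⟨ z∈cl ⟩
    rk C                    ∎)
    where open ≤-Reasoning

  -- A minimal dependent subset of (C - c) ∪ ⁅ z ⁆ through z avoids c, so its proper
  -- subsets avoiding z are proper subsets of C.
  circuit-through : ∀ {C z} → Circuit M C → z ∉ C → rk (C ∪ ⁅ z ⁆) ≡ rk C →
                    ∃ λ D → Circuit M D × z ∈ D × D ⊆ C ∪ ⁅ z ⁆
  circuit-through {C} {z} C-circ z∉C z∈cl with circuit-nonempty C-circ
  ... | c , c∈C with ⊂-minimal (λ D → (z ∈? D) ×-dec ¬? (Indep? D))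
                       (q⊆p∪q (C - c) ⁅ z ⁆ (x∈⁅x⁆ z) , circuit-exchange-dependent C-circ c∈C z∉C z∈cl)
  ... | D , D⊆C₀ , (z∈D , D-dep) , minimal =
    D , circuit-intro D-dep ⊂D⇒indep , z∈D , ∪-monoˡ-⊆ (p─q⊆p C ⁅ c ⁆) ∘ D⊆C₀
    where
    ⊂D⇒indep : ∀ {D′} → D′ ⊂ D → Indep M D′
    ⊂D⇒indep {D′} D′⊂D with z ∈? D′
    ... | yes z∈D′ = decidable-stable (Indep? D′) λ D′-dep → minimal D′⊂D (z∈D′ , D′-dep)
    ... | no z∉D′ = circuit-⊂ C-circ (p─q⊆p C ⁅ c ⁆ ∘ D′⊆C-c , c , c∈C , x∉p-x C c ∘ D′⊆C-c)
      where
      D′⊆C-c : D′ ⊆ C - c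
      D′⊆C-c {y} y∈D′ with x∈p∪q⁻ (C - c) ⁅ z ⁆ (D⊆C₀ (p⊂q⇒p⊆q D′⊂D y∈D′))
      ... | inj₁ y∈C-c = y∈C-c
      ... | inj₂ y∈⁅z⁆ = ⊥-elim (z∉D′ (subst (_∈ D′) (x∈⁅y⁆⇒x≡y z y∈⁅z⁆) y∈D′))

  cl-circuit-cyclicFlat : ∀ {C} → Circuit M C → CyclicFlat M (cl C)
  cl-circuit-cyclicFlat {C} C-circ = cl-flat C , cyclic
    where
    cyclic : UnionOfCircuits M (cl C)
    cyclic z z∈cl with z ∈? C
    ... | yes z∈C = C , C-circ , z∈C , ⊆-cl
    ... | no z∉C with circuit-through C-circ z∉C (∈-cl⁻ z∈cl)
    ...   | D , D-circ , z∈D , D⊆ = D , D-circ , z∈D , ∪-⊆ ⊆-cl (x∈p⇒⁅x⁆⊆p z∈cl) ∘ D⊆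

  -- Independence in (M|A) □ (M/A), read inside M.
  FreelySplits : Subset n → Set
  FreelySplits A = ∀ B → Indep M B ⇔ (Indep M (B ∩ A) × ∣ B ∣ ≤ rk (A ∪ B))

  rk-∪-<∣∣ : ∀ {A B C} → Circuit M C → C ⊆ B → A ⊆ cl C → rk (A ∪ B) < ∣ B ∣
  rk-∪-<∣∣ {A} {B} {C} C-circ C⊆B A⊆cl = begin-strict
    rk (A ∪ B)                    ≤⟨ rk-mono (∪-monoˡ-⊆ A⊆cl) ⟩
    rk (cl C ∪ B)                 ≤⟨ rk-∪-─ (cl C) B ⟩
    rk (cl C) + ∣ B ─ cl C ∣      ≡⟨ cong (_+ ∣ B ─ cl C ∣) (rk-cl C) ⟩
    rk C + ∣ B ─ cl C ∣           <⟨ +-monoˡ-< ∣ B ─ cl C ∣ (circuit-rk< C-circ) ⟩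
    ∣ C ∣ + ∣ B ─ cl C ∣          ≤⟨ +-monoˡ-≤ ∣ B ─ cl C ∣ (p⊆q⇒∣p∣≤∣q∣ (⊆-∩ C⊆B ⊆-cl)) ⟩
    ∣ B ∩ cl C ∣ + ∣ B ─ cl C ∣   ≡⟨ ∣p∩q∣+∣p─q∣≡∣p∣ B (cl C) ⟩
    ∣ B ∣                         ∎
    where open ≤-Reasoning

  freeSeparator-rk< : ∀ {A B} → FreeSeparator M A → ¬ Indep M B → Indep M (B ∩ A) → rk (A ∪ B) < ∣ B ∣
  freeSeparator-rk< {A} A-sep B-dep B∩A-indep with dependent⇒⊇circuit B-dep
  ... | C , C-circ , C⊆B with C ⊆? A
  ...   | yes C⊆A = ⊥-elim (proj₁ C-circ (indep-⊆ (⊆-∩ C⊆B C⊆A) B∩A-indep))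
  ...   | no C⊈A with ⊈⇒∃∈∉ C⊈A | A-sep (cl C) (cl-circuit-cyclicFlat C-circ)
  ...     | x , x∈C , x∉A | inj₁ cl⊆A = ⊥-elim (x∉A (cl⊆A (⊆-cl x∈C)))
  ...     | _ | inj₂ A⊆cl = rk-∪-<∣∣ C-circ C⊆B A⊆cl

  freeSeparator⇒freelySplits : ∀ {A} → FreeSeparator M A → FreelySplits A
  freeSeparator⇒freelySplits {A} A-sep B = mk⇔
    (λ B-indep → indep-⊆ (p∩q⊆p B A) B-indep , ≤-trans (≤-reflexive (sym B-indep)) (rk-mono (q⊆p∪q A B)))
    (λ (B∩A-indep , ∣B∣≤) → decidable-stable (Indep? B) λ B-dep →
      <⇒≱ (freeSeparator-rk< A-sep B-dep B∩A-indep) ∣B∣≤)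

  flat-rk-∪⁅⁆ : ∀ {F X y} → Flat M F → X ⊆ F → y ∉ F → suc (rk X) ≤ rk (X ∪ ⁅ y ⁆)
  flat-rk-∪⁅⁆ {F} {X} {y} F-flat X⊆F y∉F = +-cancelˡ-≤ (rk F) _ _ (begin
    rk F + suc (rk X)             ≡⟨ +-suc (rk F) (rk X) ⟩
    suc (rk F) + rk X             ≤⟨ +-mono-≤ (F-flat y y∉F) (rk-mono (⊆-∩ X⊆F (p⊆p∪q ⁅ y ⁆))) ⟩
    rk (F ∪ ⁅ y ⁆) + rk (F ∩ K)   ≤⟨ +-monoˡ-≤ (rk (F ∩ K)) (rk-mono (∪-monoʳ-⊆ (q⊆p∪q X ⁅ y ⁆))) ⟩
    rk (F ∪ K) + rk (F ∩ K)       ≤⟨ rk-submod F K ⟩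
    rk F + rk K                   ∎)
    where
    open ≤-Reasoning
    K = X ∪ ⁅ y ⁆

  flat-indep-∪⁅⁆ : ∀ {F X y} → Flat M F → X ⊆ F → y ∉ F → Indep M X → Indep M (X ∪ ⁅ y ⁆)
  flat-indep-∪⁅⁆ {F} {X} {y} F-flat X⊆F y∉F X-indep = ≤-antisym (rk-bound (X ∪ ⁅ y ⁆)) (begin
    ∣ X ∪ ⁅ y ⁆ ∣     ≡⟨ ∣p∪⁅x⁆∣≡1+∣p∣ X (y∉F ∘ X⊆F) ⟩
    suc ∣ X ∣         ≡⟨ cong suc X-indep ⟨
    suc (rk X)        ≤⟨ flat-rk-∪⁅⁆ F-flat X⊆F y∉F ⟩
    rk (X ∪ ⁅ y ⁆)    ∎)
    where open ≤-Reasoning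

  cyclicFlat-exchange : ∀ {F x y} → CyclicFlat M F → x ∈ F → y ∉ F →
                        ∃ λ J → y ∉ J × Indep M (J ∪ ⁅ y ⁆) × ¬ Indep M (J ∪ ⁅ x ⁆)
  cyclicFlat-exchange {F} {x} (F-flat , F-cyclic) x∈F y∉F with F-cyclic x x∈F
  ... | C , C-circ , x∈C , C⊆F =
    C - x , y∉F ∘ C-x⊆F , flat-indep-∪⁅⁆ F-flat C-x⊆F y∉F C-x-indep ,
    subst (¬_ ∘ Indep M) (sym (p-x∪⁅x⁆≡p x∈C)) (proj₁ C-circ)
    where
    C-x⊆F : C - x ⊆ F
    C-x⊆F = C⊆F ∘ p─q⊆p C ⁅ x ⁆
    C-x-indep : Indep M (C - x)
    C-x-indep = circuit-⊂ C-circ (p─q⊆p C ⁅ x ⁆ , x , x∈C , x∉p-x C x)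


-- Free products

-- With s = ∣ Y ∣, r = rk S and u = rk (S ∪ Z), this is ν (M/S) Z ≤ λ (M|S) Y ⇔ ∣ Y ∣ + ∣ Z ∣ ≤ u.
∸-≤-∸⇔+≤ : ∀ {s r u} d → s ≤ r → r ≤ u → d ∸ (u ∸ r) ≤ r ∸ s ⇔ s + d ≤ u
∸-≤-∸⇔+≤ {s} {r} {u} d s≤r r≤u = mk⇔
  (λ d∸≤ → subst (_≤ u) (+-comm d s) (m≤o∸n⇒m+n≤o d (≤-trans s≤r r≤u) (begin
    d                         ≤⟨ m≤n+m∸n d (u ∸ r) ⟩
    (u ∸ r) + (d ∸ (u ∸ r))   ≤⟨ +-monoʳ-≤ (u ∸ r) d∸≤ ⟩
    (u ∸ r) + (r ∸ s)         ≡⟨ split ⟩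
    u ∸ s                     ∎)))
  (λ s+d≤ → m≤n+o⇒m∸n≤o d (u ∸ r) (begin
    d                         ≤⟨ m+n≤o⇒m≤o∸n d (subst (_≤ u) (+-comm s d) s+d≤) ⟩
    u ∸ s                     ≡⟨ split ⟨
    (u ∸ r) + (r ∸ s)         ∎))
  where
  open ≤-Reasoning
  split : (u ∸ r) + (r ∸ s) ≡ u ∸ s
  split = trans (sym (+-∸-assoc (u ∸ r) s≤r)) (cong (_∸ s) (m∸n+n≡m r≤u))

∸-+-≤ : ∀ {r u v p q} → r ≤ u → r ≤ v → u + v ≤ p + q → (u ∸ r) + (v ∸ r) ≤ (p ∸ r) + (q ∸ r)
∸-+-≤ {r} {u} {v} {p} {q} r≤u r≤v u+v≤p+q = +-cancelˡ-≤ (r + r) _ _ (begin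
  (r + r) + ((u ∸ r) + (v ∸ r))    ≡⟨ interchange r (u ∸ r) r (v ∸ r) ⟨
  (r + (u ∸ r)) + (r + (v ∸ r))    ≡⟨ cong₂ _+_ (m+[n∸m]≡n r≤u) (m+[n∸m]≡n r≤v) ⟩
  u + v                            ≤⟨ u+v≤p+q ⟩
  p + q                            ≤⟨ +-mono-≤ (m≤n+m∸n p r) (m≤n+m∸n q r) ⟩
  (r + (p ∸ r)) + (r + (q ∸ r))    ≡⟨ interchange r (p ∸ r) r (q ∸ r) ⟩
  (r + r) + ((p ∸ r) + (q ∸ r))    ∎)
  where open ≤-Reasoning

module _ (σ : Fin m ↔ Fin n) where
  open Inverse σ using (from)

  private
    push : Subset m → Subset n
    push = preimage from

    ∣push∣ : ∀ P → ∣ push P ∣ ≡ ∣ P ∣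
    ∣push∣ = ∣preimage∣ (↔-sym σ)

  pullbackᴹ : Matroid n → Matroid m
  pullbackᴹ M = record
    { rk        = rk ∘ push
    ; rk-bound  = λ P → ≤-trans (rk-bound (push P)) (≤-reflexive (∣push∣ P))
    ; rk-mono   = rk-mono ∘ preimage-mono from
    ; rk-submod = λ P Q → subst₂ (λ U V → rk U + rk V ≤ rk (push P) + rk (push Q))
                    (sym (preimage-∪ from P Q)) (sym (preimage-∩ from P Q)) (rk-submod (push P) (push Q))
    }
    where open Matroid M

  module _ (M : Matroid n) where
    open Matroid M

    Indep-pullbackᴹ : ∀ P → Indep (pullbackᴹ M) P ≡ Indep M (preimage from P)
    Indep-pullbackᴹ P = cong (rk (push P) ≡_) (sym (∣push∣ P))

    pullbackᴹ-indep : ∀ B → Indep M B ⇔ Indep (pullbackᴹ M) (pullback σ B)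
    pullbackᴹ-indep B = subst₂ _⇔_
      (cong (Indep M) (preimage-inverse σ B)) (sym (Indep-pullbackᴹ (pullback σ B))) (⇔-id _)

    freelySplits-pullbackᴹ : ∀ {A} → FreelySplits M (preimage from A) → FreelySplits (pullbackᴹ M) A
    freelySplits-pullbackᴹ {A} A-splits P = subst₂ _⇔_ (sym (Indep-pullbackᴹ P)) (sym conditions) (A-splits (push P))
      where
      conditions : (Indep (pullbackᴹ M) (P ∩ A) × ∣ P ∣ ≤ rk (push (A ∪ P)))
                 ≡ (Indep M (push P ∩ push A) × ∣ push P ∣ ≤ rk (push A ∪ push P))
      conditions = cong₂ _×_
        (trans (Indep-pullbackᴹ (P ∩ A)) (cong (Indep M) (preimage-∩ from P A)))
        (cong₂ _≤_ (sym (∣push∣ P)) (cong rk (preimage-∪ from A P)))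

FreeProductIndep-++ : ∀ (N₁ : Matroid a) (N₂ : Matroid b) Y Z →
                      FreeProductIndep N₁ N₂ (Y ++ Z) ≡ (Indep N₁ Y × ν N₂ Z ≤ λ' N₁ Y)
FreeProductIndep-++ N₁ N₂ Y Z =
  cong₂ (λ Y Z → Indep N₁ Y × ν N₂ Z ≤ λ' N₁ Y) (restrictˡ-++ Y Z) (restrictʳ-++ Y Z)

module _ (M : Matroid (a + b)) where
  open Matroid M

  restrictionˡ : Matroid a
  restrictionˡ = record
    { rk        = λ Y → rk (Y ++ ⊥)
    ; rk-bound  = λ Y → ≤-trans (rk-bound (Y ++ ⊥)) (≤-reflexive (∣p++⊥∣≡∣p∣ Y))
    ; rk-mono   = λ Y⊆Y′ → rk-mono (++⁺-⊆ Y⊆Y′ ⊆-refl)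
    ; rk-submod = λ Y Y′ → subst₂ (λ U V → rk U + rk V ≤ rk (Y ++ ⊥) + rk (Y′ ++ ⊥))
                    (trans (zipWith-++ _∨_ Y ⊥ Y′ ⊥) (cong ((Y ∪ Y′) ++_) (∪-idem ⊥)))
                    (trans (zipWith-++ _∧_ Y ⊥ Y′ ⊥) (cong ((Y ∩ Y′) ++_) (∩-idem ⊥)))
                    (rk-submod (Y ++ ⊥) (Y′ ++ ⊥))
    }

  contractionˡ : Matroid b
  contractionˡ = record
    { rk        = λ Z → rk (⊤++ Z) ∸ r
    ; rk-bound  = λ Z → m≤n+o⇒m∸n≤o (rk (⊤++ Z)) r (rk-⊤++≤ Z)
    ; rk-mono   = λ Z⊆Z′ → ∸-monoˡ-≤ r (rk-mono (⊤++-mono Z⊆Z′))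
    ; rk-submod = λ Z Z′ → ∸-+-≤ (rk-mono (⊤++-mono ⊥⊆)) (rk-mono (⊤++-mono ⊥⊆))
                    (subst₂ (λ U V → rk U + rk V ≤ rk (⊤++ Z) + rk (⊤++ Z′))
                      (trans (zipWith-++ _∨_ ⊤ Z ⊤ Z′) (cong (_++ (Z ∪ Z′)) (∪-idem ⊤)))
                      (trans (zipWith-++ _∧_ ⊤ Z ⊤ Z′) (cong (_++ (Z ∩ Z′)) (∩-idem ⊤)))
                      (rk-submod (⊤++ Z) (⊤++ Z′)))
    }
    where
    ⊤++ : Subset b → Subset (a + b)
    ⊤++ Z = ⊤ ++ Z
    ⊤++-mono : ∀ {Z Z′} → Z ⊆ Z′ → ⊤++ Z ⊆ ⊤++ Z′
    ⊤++-mono = ++⁺-⊆ {Y = ⊤} ⊆-refl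
    r : ℕ
    r = rk (⊤++ ⊥)
    rk-⊤++≤ : ∀ Z → rk (⊤++ Z) ≤ r + ∣ Z ∣
    rk-⊤++≤ Z = begin
      rk (⊤++ Z)                     ≡⟨ cong rk (trans (zipWith-++ _∨_ ⊤ ⊥ ⊥ Z) (cong₂ _++_ (∪-identityʳ ⊤) (∪-identityˡ Z))) ⟨
      rk (⊤++ ⊥ ∪ (⊥ {a} ++ Z))      ≤⟨ rk-∪-≤ M (⊤++ ⊥) (⊥ ++ Z) ⟩
      r + ∣ ⊥ {a} ++ Z ∣             ≡⟨ cong (r +_) (∣⊥++q∣≡∣q∣ {a = a} Z) ⟩
      r + ∣ Z ∣                      ∎
      where open ≤-Reasoning

  indep-++ : FreelySplits M (firstBlock a b) → ∀ Y Z →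
             Indep M (Y ++ Z) ⇔ (Indep restrictionˡ Y × ∣ Y ∣ + ∣ Z ∣ ≤ rk (⊤ {a} ++ Z))
  indep-++ S-splits Y Z = subst (Indep M (Y ++ Z) ⇔_) conditions (S-splits (Y ++ Z))
    where
    conditions : (Indep M ((Y ++ Z) ∩ firstBlock a b) × ∣ Y ++ Z ∣ ≤ rk (firstBlock a b ∪ (Y ++ Z)))
               ≡ (Indep restrictionˡ Y × ∣ Y ∣ + ∣ Z ∣ ≤ rk (⊤ ++ Z))
    conditions = cong₂ _×_
      (trans (cong (Indep M) (trans (zipWith-++ _∧_ Y Z ⊤ ⊥) (cong₂ _++_ (∩-identityʳ Y) (∩-zeroʳ Z))))
             (cong (rk (Y ++ ⊥) ≡_) (∣p++⊥∣≡∣p∣ Y)))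
      (cong₂ _≤_ (∣++∣ Y Z)
        (cong rk (trans (zipWith-++ _∨_ ⊤ ⊥ Y Z) (cong₂ _++_ (∪-zeroˡ Y) (∪-identityˡ Z)))))

  indep-++⇔freeProduct : FreelySplits M (firstBlock a b) → ∀ Y Z →
                         Indep M (Y ++ Z) ⇔ (Indep restrictionˡ Y × ν contractionˡ Z ≤ λ' restrictionˡ Y)
  indep-++⇔freeProduct S-splits Y Z = mk⇔
    (λ YZ-indep → let (Y-indep , ∣Y∣+∣Z∣≤) = to YZ-indep in Y-indep , Equivalence.from (bound Y-indep) ∣Y∣+∣Z∣≤)
    (λ (Y-indep , ν≤λ) → from (Y-indep , Equivalence.to (bound Y-indep) ν≤λ))
    where
    open Equivalence (indep-++ S-splits Y Z)
    r = rk (firstBlock a b)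
    u = rk (⊤ {a} ++ Z)
    bound : Indep restrictionˡ Y → ν contractionˡ Z ≤ λ' restrictionˡ Y ⇔ ∣ Y ∣ + ∣ Z ∣ ≤ u
    bound Y-indep = subst (λ s → ∣ Z ∣ ∸ (u ∸ r) ≤ r ∸ s ⇔ ∣ Y ∣ + ∣ Z ∣ ≤ u) (sym Y-indep)
      (∸-≤-∸⇔+≤ ∣ Z ∣ (subst (_≤ r) Y-indep (rk-mono (++⁺-⊆ {a = a} {b = b} ⊆⊤ ⊆-refl)))
                      (rk-mono (++⁺-⊆ {a = a} {b = b} ⊆-refl ⊥⊆)))

  freelySplits⇒factorization : FreelySplits M (firstBlock a b) →
                               ∀ P → Indep M P ⇔ FreeProductIndep restrictionˡ contractionˡ P
  freelySplits⇒factorization S-splits P =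
    subst (λ P → Indep M P ⇔ FreeProductIndep restrictionˡ contractionˡ P) (restrict-++ a P)
      (subst (Indep M (Y ++ Z) ⇔_) (sym (FreeProductIndep-++ restrictionˡ contractionˡ Y Z))
        (indep-++⇔freeProduct S-splits Y Z))
    where
    Y = restrictˡ {a} P
    Z = restrictʳ {a} P

module _ (N₁ : Matroid a) (N₂ : Matroid b) where
  private
    module N₁ = Matroid N₁
    module N₂ = Matroid N₂

  freeProduct-exchange : ∀ {Y Z i j} → i ∉ Y →
                         FreeProductIndep N₁ N₂ ((Y ∪ ⁅ i ⁆) ++ Z) → FreeProductIndep N₁ N₂ (Y ++ (Z ∪ ⁅ j ⁆))
  freeProduct-exchange {Y} {Z} {i} {j} i∉Y P-indep
    with subst id (FreeProductIndep-++ N₁ N₂ (Y ∪ ⁅ i ⁆) Z) P-indep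
  ... | Y+i-indep , ν≤λ = subst id (sym (FreeProductIndep-++ N₁ N₂ Y (Z ∪ ⁅ j ⁆))) (Y-indep , (begin
    ∣ Z ∪ ⁅ j ⁆ ∣ ∸ N₂.rk (Z ∪ ⁅ j ⁆)   ≤⟨ ∸-mono (∣p∪⁅x⁆∣≤1+∣p∣ Z j) (N₂.rk-mono (p⊆p∪q ⁅ j ⁆)) ⟩
    suc ∣ Z ∣ ∸ N₂.rk Z                 ≡⟨ +-∸-assoc 1 (N₂.rk-bound Z) ⟩
    suc (∣ Z ∣ ∸ N₂.rk Z)               ≤⟨ s≤s ν≤λ ⟩
    suc (r₁ ∸ N₁.rk (Y ∪ ⁅ i ⁆))        ≡⟨ cong (λ k → suc (r₁ ∸ k)) rk-Y+i ⟩
    suc (r₁ ∸ suc ∣ Y ∣)                ≡⟨ +-∸-assoc 1 (≤-trans (≤-reflexive (sym rk-Y+i)) (N₁.rk-mono ⊆⊤)) ⟨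
    r₁ ∸ ∣ Y ∣                          ≡⟨ cong (r₁ ∸_) Y-indep ⟨
    r₁ ∸ N₁.rk Y                        ∎))
    where
    open ≤-Reasoning
    r₁ = rank N₁
    rk-Y+i : N₁.rk (Y ∪ ⁅ i ⁆) ≡ suc ∣ Y ∣
    rk-Y+i = trans Y+i-indep (∣p∪⁅x⁆∣≡1+∣p∣ Y i∉Y)
    Y-indep : Indep N₁ Y
    Y-indep = indep-⊆ N₁ (p⊆p∪q ⁅ i ⁆) Y+i-indep

freeProduct-emptyˡ : ∀ (N₁ : Matroid 0) (N₂ : Matroid b) P → FreeProductIndep N₁ N₂ P ⇔ Indep N₂ P
freeProduct-emptyˡ N₁ N₂ P = subst (λ Z → FreeProductIndep N₁ N₂ P ⇔ Indep N₂ Z) (restrictʳ-++ [] P) (mk⇔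
  (λ (_ , ν≤λ) → Equivalence.from (Indep⇔ν≤0 N₂ _) (≤-trans ν≤λ (≤-reflexive λ≡0)))
  (λ Z-indep → ∅-indep , ≤-trans (Equivalence.to (Indep⇔ν≤0 N₂ _) Z-indep) z≤n))
  where
  ∅-indep : Indep N₁ []
  ∅-indep = n≤0⇒n≡0 (Matroid.rk-bound N₁ [])
  λ≡0 : λ' N₁ [] ≡ 0
  λ≡0 = n∸n≡0 (Matroid.rk N₁ [])

freeProduct-emptyʳ : ∀ (N₁ : Matroid a) (N₂ : Matroid 0) P → FreeProductIndep N₁ N₂ P ⇔ Indep N₁ (restrictˡ P)
freeProduct-emptyʳ N₁ N₂ P = mk⇔ proj₁ (_, ≤-trans (≤-reflexive (0∸n≡0 (Matroid.rk N₂ []))) z≤n)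


+-identityʳ-↔ : ∀ a → Fin a ↔ Fin (a + 0)
+-identityʳ-↔ a = mk↔ₛ′ (_↑ˡ 0) (λ k → [ id , (λ ()) ]′ (splitAt a k)) ↑ˡ∘from from∘↑ˡ
  where
  ↑ˡ∘from : ∀ k → [ id , (λ ()) ]′ (splitAt a k) ↑ˡ 0 ≡ k
  ↑ˡ∘from k with splitAt a k in eq
  ... | inj₁ i = splitAt⁻¹-↑ˡ eq
  from∘↑ˡ : ∀ i → [ id , (λ ()) ]′ (splitAt a (i ↑ˡ 0)) ≡ i
  from∘↑ˡ i rewrite splitAt-↑ˡ a i 0 = refl

consˡ : (Fin a ⊎ Fin b) ↔ Fin n → (Fin (suc a) ⊎ Fin b) ↔ Fin (suc n)
consˡ σ = mk↔ₛ′ to′ from′ to∘from from∘to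
  where
  open Inverse σ
  to′ : Fin (suc _) ⊎ Fin _ → Fin (suc _)
  to′ (inj₁ zero)    = zero
  to′ (inj₁ (suc i)) = suc (to (inj₁ i))
  to′ (inj₂ j)       = suc (to (inj₂ j))
  from′ : Fin (suc _) → Fin (suc _) ⊎ Fin _
  from′ zero    = inj₁ zero
  from′ (suc z) = map₁ suc (from z)
  to′-map₁ : ∀ w → to′ (map₁ suc w) ≡ suc (to w)
  to′-map₁ (inj₁ _) = refl
  to′-map₁ (inj₂ _) = refl
  to∘from : ∀ z → to′ (from′ z) ≡ z
  to∘from zero    = refl
  to∘from (suc z) = trans (to′-map₁ (from z)) (cong suc (strictlyInverseˡ z))
  from∘to : ∀ w → from′ (to′ w) ≡ w
  from∘to (inj₁ zero)    = refl
  from∘to (inj₁ (suc i)) = cong (map₁ suc) (strictlyInverseʳ (inj₁ i))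
  from∘to (inj₂ j)       = cong (map₁ suc) (strictlyInverseʳ (inj₂ j))

consʳ : (Fin a ⊎ Fin b) ↔ Fin n → (Fin a ⊎ Fin (suc b)) ↔ Fin (suc n)
consʳ σ = consˡ (σ ↔-∘ ⊎-comm _ _) ↔-∘ ⊎-comm _ _

blocks⊎ : ∀ (A : Subset n) → ∃ λ (σ : (Fin ∣ A ∣ ⊎ Fin ∣ ∁ A ∣) ↔ Fin n) →
          (∀ i → Inverse.to σ (inj₁ i) ∈ A) × (∀ j → Inverse.to σ (inj₂ j) ∉ A)
blocks⊎ [] = ↔-sym +↔⊎ , (λ ()) , (λ ())
blocks⊎ (true ∷ A) with blocks⊎ A
... | σ , in-A , out-A = consˡ σ , (λ { zero → here ; (suc i) → there (in-A i) }) , (λ j → out-A j ∘ drop-there)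
blocks⊎ (false ∷ A) with blocks⊎ A
... | σ , in-A , out-A = consʳ σ , (λ i → there (in-A i)) , (λ { zero () ; (suc j) → out-A j ∘ drop-there })

blocks : ∀ (A : Subset n) → ∃ λ (σ : Fin (∣ A ∣ + ∣ ∁ A ∣) ↔ Fin n) → pullback σ A ≡ firstBlock ∣ A ∣ ∣ ∁ A ∣
blocks A with blocks⊎ A
... | σ , in-A , out-A = τ , trans (sym (restrict-++ ∣ A ∣ P)) (cong₂ _++_ left≡⊤ right≡⊥)
  where
  τ = σ ↔-∘ +↔⊎
  P = pullback τ A
  left≡⊤ : restrictˡ P ≡ ⊤
  left≡⊤ = ⊆-antisym ⊆⊤ λ {i} _ → ∈-preimage⁺ (_↑ˡ ∣ ∁ A ∣) (∈-preimage⁺ (Inverse.to τ)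
    (subst (λ w → Inverse.to σ w ∈ A) (sym (splitAt-↑ˡ ∣ A ∣ i _)) (in-A i)))
  right≡⊥ : restrictʳ {∣ A ∣} P ≡ ⊥
  right≡⊥ = Empty-unique λ (j , j∈) → out-A j (subst (λ w → Inverse.to σ w ∈ A) (splitAt-↑ʳ ∣ A ∣ _ j)
    (∈-preimage⁻ (Inverse.to τ) (∈-preimage⁻ (∣ A ∣ ↑ʳ_) j∈)))

-- Factorizations

module _ (M : Matroid n) where

  factorization-emptyˡ : ∀ (N₁ : Matroid 0) (N₂ : Matroid b) → IsFactorization M N₁ N₂ → N₂ ≅ᴹ M
  factorization-emptyˡ N₁ N₂ (σ , factor) = σ , λ B → freeProduct-emptyˡ N₁ N₂ (pullback σ B) ⇔-∘ factor B

  factorization-emptyʳ : ∀ (N₁ : Matroid a) (N₂ : Matroid 0) → IsFactorization M N₁ N₂ → N₁ ≅ᴹ M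
  factorization-emptyʳ {a = a} N₁ N₂ (σ , factor) = σ ↔-∘ +-identityʳ-↔ a , λ B →
    subst (Indep M B ⇔_) (cong (Indep N₁) (preimage-∘ (Inverse.to σ) (_↑ˡ 0) B))
      (freeProduct-emptyʳ N₁ N₂ (pullback σ B) ⇔-∘ factor B)

module FirstFactor (M : Matroid n) (N₁ : Matroid a) (N₂ : Matroid b)
                   (factorization : IsFactorization M N₁ N₂) where
  private
    σ = proj₁ factorization
    factor = proj₂ factorization
  open Inverse σ using (to; from; strictlyInverseˡ; strictlyInverseʳ)

  S : Subset n
  S = preimage from (firstBlock a b)

  ∈S⇒↑ˡ : ∀ {z} → z ∈ S → ∃ λ i → from z ≡ i ↑ˡ b
  ∈S⇒↑ˡ {z} z∈S with ↑ˡ⊎↑ʳ a (from z)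
  ... | inj₁ left = left
  ... | inj₂ (j , eq) = ⊥-elim (↑ʳ∉firstBlock j (subst (_∈ firstBlock a b) eq (∈-preimage⁻ from z∈S)))

  ∉S⇒↑ʳ : ∀ {z} → z ∉ S → ∃ λ j → from z ≡ a ↑ʳ j
  ∉S⇒↑ʳ {z} z∉S with ↑ˡ⊎↑ʳ a (from z)
  ... | inj₁ (i , eq) = ⊥-elim (z∉S (∈-preimage⁺ from (subst (_∈ firstBlock a b) (sym eq) (↑ˡ∈firstBlock i))))
  ... | inj₂ right = right

  cyclicFlat-⊈S⇒⊇S : ∀ {F x y} → CyclicFlat M F → x ∈ F → x ∉ S → y ∉ F → y ∉ S
  cyclicFlat-⊈S⇒⊇S {F} {x} {y} F-cyclicFlat x∈F x∉S y∉F y∈S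
    with ∉S⇒↑ʳ x∉S | ∈S⇒↑ˡ y∈S | cyclicFlat-exchange M F-cyclicFlat x∈F y∉F
  ... | j , from-x | i , from-y | J , y∉J , J+y-indep , J+x-dep =
    J+x-dep (Equivalence.from (factor (J ∪ ⁅ x ⁆)) (subst (FreeProductIndep N₁ N₂) (sym J+x≡)
      (freeProduct-exchange N₁ N₂ i∉Y (subst (FreeProductIndep N₁ N₂) J+y≡
        (Equivalence.to (factor (J ∪ ⁅ y ⁆)) J+y-indep)))))
    where
    Y = restrictˡ {a} (pullback σ J)
    Z = restrictʳ {a} (pullback σ J)
    J≡ : pullback σ J ≡ Y ++ Z
    J≡ = sym (restrict-++ a (pullback σ J))
    J+y≡ : pullback σ (J ∪ ⁅ y ⁆) ≡ (Y ∪ ⁅ i ⁆) ++ Z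
    J+y≡ = trans (preimage-∪⁅⁆ σ J y) (trans (cong₂ (λ P k → P ∪ ⁅ k ⁆) J≡ from-y) (++-∪-⁅↑ˡ⁆ Y Z i))
    J+x≡ : pullback σ (J ∪ ⁅ x ⁆) ≡ Y ++ (Z ∪ ⁅ j ⁆)
    J+x≡ = trans (preimage-∪⁅⁆ σ J x) (trans (cong₂ (λ P k → P ∪ ⁅ k ⁆) J≡ from-x) (++-∪-⁅↑ʳ⁆ Y Z j))
    i∉Y : i ∉ Y
    i∉Y i∈Y = y∉J (subst (_∈ J) (trans (cong to (sym from-y)) (strictlyInverseˡ y))
                     (∈-preimage⁻ to (∈-preimage⁻ (_↑ˡ b) i∈Y)))

  S-freeSeparator : FreeSeparator M S
  S-freeSeparator F F-cyclicFlat with F ⊆? S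
  ... | yes F⊆S = inj₁ F⊆S
  ... | no F⊈S with ⊈⇒∃∈∉ F⊈S
  ...   | x , x∈F , x∉S = inj₂ λ {y} y∈S →
          decidable-stable (y ∈? F) λ y∉F → cyclicFlat-⊈S⇒⊇S F-cyclicFlat x∈F x∉S y∉F y∈S

  S-nontrivial : Fin a → Fin b → NontrivialFreeSeparator M S
  S-nontrivial i j = S-freeSeparator , (λ S≡⊥ → ∉⊥ (subst (to (i ↑ˡ b) ∈_) S≡⊥ (inS i)))
                                    , (λ S≡⊤ → outS j (subst (to (a ↑ʳ j) ∈_) (sym S≡⊤) ∈⊤))
    where
    inS : ∀ i → to (i ↑ˡ b) ∈ S
    inS i = ∈-preimage⁺ from (subst (_∈ firstBlock a b) (sym (strictlyInverseʳ _)) (↑ˡ∈firstBlock i))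
    outS : ∀ j → to (a ↑ʳ j) ∉ S
    outS j = ↑ʳ∉firstBlock j ∘ subst (_∈ firstBlock a b) (strictlyInverseʳ _) ∘ ∈-preimage⁻ from

module _ (M : Matroid n) where

  freeSeparator⇒factorization : ∀ {A} → FreeSeparator M A → (σ : Fin (a + b) ↔ Fin n) →
    pullback σ A ≡ firstBlock a b →
    IsFactorization M (restrictionˡ {a = a} {b} (pullbackᴹ σ M)) (contractionˡ {a = a} {b} (pullbackᴹ σ M))
  freeSeparator⇒factorization {a = a} {b} {A} A-sep σ σ*A≡S = σ , λ B →
    freelySplits⇒factorization {a = a} {b} (pullbackᴹ σ M) S-splits (pullback σ B) ⇔-∘ pullbackᴹ-indep σ M B
    where
    A≡ : A ≡ preimage (Inverse.from σ) (firstBlock a b)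
    A≡ = trans (sym (preimage-inverse σ A)) (cong (preimage (Inverse.from σ)) σ*A≡S)
    S-splits : FreelySplits (pullbackᴹ σ M) (firstBlock a b)
    S-splits = freelySplits-pullbackᴹ σ M (subst (FreelySplits M) A≡ (freeSeparator⇒freelySplits M A-sep))

  irreducible⇒noFreeSeparator : Irreducible M → ¬ ∃ (NontrivialFreeSeparator M)
  irreducible⇒noFreeSeparator (_ , factors-trivially) (A , A-sep , A≢⊥ , A≢⊤) with blocks A
  ... | σ , σ*A≡S with factors-trivially _ _ (restrictionˡ {a = ∣ A ∣} (pullbackᴹ σ M))
                                             (contractionˡ {a = ∣ A ∣} (pullbackᴹ σ M))
                                             (freeSeparator⇒factorization {a = ∣ A ∣} A-sep σ σ*A≡S)
  ...   | inj₁ (τ , _) = A≢⊤ (∣p∣≡n⇒p≡⊤ (↔⇒≡ τ))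
  ...   | inj₂ (τ , _) = A≢⊥ (∣∁p∣≡n⇒p≡⊥ (↔⇒≡ τ))

  noFreeSeparator⇒factorsTrivially : ¬ ∃ (NontrivialFreeSeparator M) →
    ∀ a b (N₁ : Matroid a) (N₂ : Matroid b) → IsFactorization M N₁ N₂ → N₁ ≅ᴹ M ⊎ N₂ ≅ᴹ M
  noFreeSeparator⇒factorsTrivially _ zero _ N₁ N₂ M≅N₁□N₂ = inj₂ (factorization-emptyˡ M N₁ N₂ M≅N₁□N₂)
  noFreeSeparator⇒factorsTrivially _ (suc _) zero N₁ N₂ M≅N₁□N₂ = inj₁ (factorization-emptyʳ M N₁ N₂ M≅N₁□N₂)
  noFreeSeparator⇒factorsTrivially none (suc _) (suc _) N₁ N₂ M≅N₁□N₂ =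
    ⊥-elim (none (S , S-nontrivial zero zero))
    where open FirstFactor M N₁ N₂ M≅N₁□N₂

theorem6p4 : ∀ {n : ℕ} (M : Matroid n) → 0 < n →
    (Irreducible M ⇔ (¬ (∃ λ (A : Subset n) → NontrivialFreeSeparator M A)))
theorem6p4 M 0<n = mk⇔ (irreducible⇒noFreeSeparator M) λ none → 0<n , noFreeSeparator⇒factorsTrivially M none
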